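{- Let $G$ be a strongly regular graph on $v$ vertices with valency $k$ and adjacency eigenvalues $k>\theta_1>\theta_2$. Let $t$ be such that $v=2t$ or $v=2t+1$. If $tk-(2t+1)\theta_1+(t+1)\theta_2\ge0$, then $h_G\le\lambda_1$, where $\lambda_1=(k-\theta_1)/k$.
   Context: A strongly regular graph is a connected distance-regular graph of diameter 2; it has exactly three distinct adjacency eigenvalues. For $A,B\subseteq V(G)$, $E[A,B]$ is the number of ordered pairs $(x,y)$ with $x\in A$, $y\in B$, $x\sim y$; $\mathrm{vol}(S)=\sum_{x\in S}\deg(x)$; $S^c=V(G)\setminus S$. The Cheeger constant is $h_G=\min\{E[S,S^c]/\mathrm{vol}(S):\emptyset\ne S\subseteq V(G),\ |S|\le|V(G)|/2\}$. -}

module Defs where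

open import Data.Nat as ℕ using (ℕ; zero; suc)
open import Data.Fin using (Fin; zero; suc)
open import Data.Bool using (Bool; true; false; if_then_else_; _∧_; not)
open import Data.Product using (Σ; ∃; ∃-syntax; _×_; _,_)
open import Data.Sum using (_⊎_)
open import Relation.Binary.PropositionalEquality using (_≡_; _≢_)
open import Algebra.Core using (Op₁; Op₂)
open import Algebra.Structures using (IsCommutativeRing)
open import Relation.Binary.Structures using (IsTotalOrder)

-- Ordered fields (stand-in for ℝ; the stdlib has no reals).  The inverse is total; only its value on
-- nonzero elements is constrained (x ⁻¹ is only ever applied to vol(S) > 0).

record OrderedField : Set₁ where
  infixl 6 _+_ _-_
  infixl 7 _*_
  infix 4 _≤_ _<_
  field
    Carrier : Set
    _+_ _*_ : Op₂ Carrier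
    -_      : Op₁ Carrier
    0# 1#   : Carrier
    _⁻¹     : Op₁ Carrier
    _≤_     : Carrier → Carrier → Set
    isCommutativeRing : IsCommutativeRing _≡_ _+_ _*_ -_ 0# 1#
    0≢1      : 0# ≢ 1#
    ⁻¹-inverse : ∀ x → x ≢ 0# → x * (x ⁻¹) ≡ 1#
    isTotalOrder : IsTotalOrder _≡_ _≤_
    +-mono-≤  : ∀ {x y} z → x ≤ y → x + z ≤ y + z
    *-nonneg  : ∀ {x y} → 0# ≤ x → 0# ≤ y → 0# ≤ x * y

  _-_ : Op₂ Carrier
  x - y = x + (- y)

  _<_ : Carrier → Carrier → Set
  x < y = (x ≤ y) × (x ≢ y)

  fromℕ : ℕ → Carrier
  fromℕ zero    = 0#
  fromℕ (suc n) = 1# + fromℕ n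

  Σ[_] : ∀ {n} → (Fin n → Carrier) → Carrier
  Σ[_] {zero}  f = 0#
  Σ[_] {suc n} f = f zero + Σ[_] (λ i → f (suc i))

record Graph (n : ℕ) : Set where
  field
    adj    : Fin n → Fin n → Bool
    sym    : ∀ i j → adj i j ≡ adj j i
    irrefl : ∀ i → adj i i ≡ false
open Graph public

count : ∀ {n} → (Fin n → Bool) → ℕ
count {zero}  p = 0
count {suc n} p = (if p zero then 1 else 0) ℕ.+ count (λ i → p (suc i))

sumℕ : ∀ {n} → (Fin n → ℕ) → ℕ
sumℕ {zero}  f = 0
sumℕ {suc n} f = f zero ℕ.+ sumℕ (λ i → f (suc i))

module _ {n : ℕ} (G : Graph n) where

  deg : Fin n → ℕ
  deg x = count (adj G x)

  commonNbrs : Fin n → Fin n → ℕ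
  commonNbrs x y = count (λ z → adj G x z ∧ adj G z y)

  Diameter2 : Set
  Diameter2 =
    (∀ x y → x ≢ y → adj G x y ≡ false → ∃[ z ] (adj G x z ≡ true × adj G z y ≡ true))
    × (∃[ x ] ∃[ y ] (x ≢ y × adj G x y ≡ false))

  IsStronglyRegular : (k : ℕ) → Set
  IsStronglyRegular k =
    (∀ x → deg x ≡ k)
    × (∃[ λ' ] ∃[ μ ]
        ((∀ x y → adj G x y ≡ true → commonNbrs x y ≡ λ')
         × (∀ x y → x ≢ y → adj G x y ≡ false → commonNbrs x y ≡ μ)))
    × Diameter2

  VSubset : Set
  VSubset = Fin n → Bool

  edgesOut : VSubset → ℕ
  edgesOut S = sumℕ (λ x → count (λ y → S x ∧ not (S y) ∧ adj G x y))

  vol : VSubset → ℕ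
  vol S = sumℕ (λ x → if S x then deg x else 0)

  size : VSubset → ℕ
  size S = count S

  Admissible : VSubset → Set
  Admissible S = (∃[ x ] S x ≡ true) × (2 ℕ.* size S ℕ.≤ n)

  module _ (F : OrderedField) where
    open OrderedField F

    A : Fin n → Fin n → Carrier
    A x y = if adj G x y then 1# else 0#

    IsEigenvalue : Carrier → Set
    IsEigenvalue θ = Σ (Fin n → Carrier) λ v → (∃[ i ] v i ≢ 0#)
                     × (∀ i → Σ[_] {n} (λ j → A i j * v j) ≡ θ * v i)

    HasEigenvalues : Carrier → Carrier → Carrier → Set
    HasEigenvalues k θ₁ θ₂ =
      IsEigenvalue k × IsEigenvalue θ₁ × IsEigenvalue θ₂
      × (∀ θ → IsEigenvalue θ → θ ≡ k ⊎ θ ≡ θ₁ ⊎ θ ≡ θ₂)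
      × (θ₁ < k) × (θ₂ < θ₁)

    ratio : VSubset → Carrier
    ratio S = fromℕ (edgesOut S) * (fromℕ (vol S)) ⁻¹

    IsCheegerConstant : Carrier → Set
    IsCheegerConstant h =
      (∃[ S ] (Admissible S × ratio S ≡ h))
      × (∀ S → Admissible S → h ≤ ratio S)

module Submission where

-- On vectors summing to zero, strong regularity reads
-- A² = (k − μ) + (λ − μ)A, so θ₁ and θ₂ are the two roots of this quadratic
-- and (A − θ₁)(A − θ₂) vanishes there.  Writing (θ₁ − θ₂)x as the difference
-- of the eigenvectors (A − θ₂)x and (A − θ₁)x gives ⟨x, Ax⟩ ≥ θ₂⟨x, x⟩.
-- Testing this on x = v·𝟙_S − |S|·𝟙 yields v·E[S,Sᶜ] ≤ |S|(v − |S|)(k − θ₂).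
-- For S the first t vertices (admissible since 2t ≤ v) the hypothesis says
-- (v − t)(k − θ₂) ≤ v(k − θ₁), so E[S,Sᶜ] ≤ t(k − θ₁) = vol(S)(k − θ₁)/k.

open import Defs hiding (sym)
open import Data.Nat as ℕ using (ℕ; zero; suc)
import Data.Nat.Properties as ℕP
open import Data.Integer as ℤ using (ℤ; -[1+_]; sign; ∣_∣; _◃_; _⊖_)
import Data.Integer.Properties as ℤP
open import Data.Sign as Sign using (Sign)
open import Data.Fin using (Fin; zero; suc)
open import Data.Bool using (Bool; true; false; if_then_else_; _∧_; not)
open import Data.Bool.Properties using (∧-idem)
open import Data.Maybe using (Maybe; just; nothing)
open import Data.Product using (∃-syntax; _,_; proj₁; proj₂)
open import Data.Sum using (_⊎_; inj₁; inj₂)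
open import Data.Empty using (⊥-elim)
open import Relation.Nullary using (yes; no; does)
import Data.Fin.Properties as Fin
open import Relation.Binary.PropositionalEquality
open import Relation.Binary.Structures using (IsTotalOrder)
open import Relation.Binary.Bundles using (Poset)
import Relation.Binary.Reasoning.PartialOrder as PartialOrderReasoning
open import Algebra.Bundles using (CommutativeRing)
open import Algebra.Solver.Ring.AlmostCommutativeRing
  using (AlmostCommutativeRing; fromCommutativeRing; _-Raw-AlmostCommutative⟶_)

module FieldArithmetic (F : OrderedField) where
  open OrderedField F

  commutativeRing : CommutativeRing _ _
  commutativeRing = record { isCommutativeRing = isCommutativeRing }

  open CommutativeRing commutativeRing public
    using (+-assoc; +-comm; *-assoc; *-comm; +-identityˡ; +-identityʳ;
           *-identityˡ; *-identityʳ; -‿inverseʳ; distribˡ; distribʳ;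
           zeroˡ; zeroʳ; ring)
  open import Algebra.Properties.Ring ring public
    using (-‿distribˡ-*; -‿distribʳ-*; -‿involutive; -0#≈0#; -‿+-comm)

  fromℕ-+ : ∀ m n → fromℕ (m ℕ.+ n) ≡ fromℕ m + fromℕ n
  fromℕ-+ zero    n = sym (+-identityˡ _)
  fromℕ-+ (suc m) n = trans (cong (1# +_) (fromℕ-+ m n)) (sym (+-assoc _ _ _))

  fromℕ-* : ∀ m n → fromℕ (m ℕ.* n) ≡ fromℕ m * fromℕ n
  fromℕ-* zero    n = sym (zeroˡ _)
  fromℕ-* (suc m) n = begin
      fromℕ (n ℕ.+ m ℕ.* n)             ≡⟨ fromℕ-+ n (m ℕ.* n) ⟩
      fromℕ n + fromℕ (m ℕ.* n)         ≡⟨ cong₂ _+_ (sym (*-identityˡ _)) (fromℕ-* m n) ⟩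
      1# * fromℕ n + fromℕ m * fromℕ n  ≡⟨ sym (distribʳ _ _ _) ⟩
      (1# + fromℕ m) * fromℕ n          ∎
    where open ≡-Reasoning

  -- The canonical ring homomorphism ℤ → F; it lets the ring solver use
  -- integer coefficients, whose equality is decidable.
  private
    signed : Sign → Carrier → Carrier
    signed Sign.+ x = x
    signed Sign.- x = - x

    signed-* : ∀ s s′ x y → signed (s Sign.* s′) (x * y) ≡ signed s x * signed s′ y
    signed-* Sign.+ Sign.+ x y = refl
    signed-* Sign.+ Sign.- x y = -‿distribʳ-* x y
    signed-* Sign.- Sign.+ x y = -‿distribˡ-* x y
    signed-* Sign.- Sign.- x y = begin
        x * y              ≡⟨ sym (-‿involutive _) ⟩
        - - (x * y)        ≡⟨ cong -_ (-‿distribʳ-* x y) ⟩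
        - (x * - y)        ≡⟨ -‿distribˡ-* x (- y) ⟩
        - x * - y          ∎
      where open ≡-Reasoning

  fromℤ : ℤ → Carrier
  fromℤ i = signed (sign i) (fromℕ ∣ i ∣)

  private
    fromℤ-◃ : ∀ s n → fromℤ (s ◃ n) ≡ signed s (fromℕ n)
    fromℤ-◃ Sign.+ zero    = refl
    fromℤ-◃ Sign.- zero    = sym -0#≈0#
    fromℤ-◃ Sign.+ (suc n) = refl
    fromℤ-◃ Sign.- (suc n) = refl

    fromℤ-* : ∀ i j → fromℤ (i ℤ.* j) ≡ fromℤ i * fromℤ j
    fromℤ-* i j = trans (fromℤ-◃ (sign i Sign.* sign j) (∣ i ∣ ℕ.* ∣ j ∣))
      (trans (cong (signed (sign i Sign.* sign j)) (fromℕ-* ∣ i ∣ ∣ j ∣))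
             (signed-* (sign i) (sign j) _ _))

    cancel-1# : ∀ a b → (1# + a) + - (1# + b) ≡ a + - b
    cancel-1# a b = begin
        (1# + a) + - (1# + b)     ≡⟨ cong ((1# + a) +_) (sym (-‿+-comm 1# b)) ⟩
        (1# + a) + (- 1# + - b)   ≡⟨ +-assoc 1# a _ ⟩
        1# + (a + (- 1# + - b))   ≡⟨ cong (1# +_) (sym (+-assoc a _ _)) ⟩
        1# + ((a + - 1#) + - b)   ≡⟨ cong (λ z → 1# + (z + - b)) (+-comm a _) ⟩
        1# + ((- 1# + a) + - b)   ≡⟨ cong (1# +_) (+-assoc _ _ _) ⟩
        1# + (- 1# + (a + - b))   ≡⟨ sym (+-assoc _ _ _) ⟩
        (1# + - 1#) + (a + - b)   ≡⟨ cong (_+ (a + - b)) (-‿inverseʳ 1#) ⟩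
        0# + (a + - b)            ≡⟨ +-identityˡ _ ⟩
        a + - b                   ∎
      where open ≡-Reasoning

    fromℤ-⊖ : ∀ m n → fromℤ (m ⊖ n) ≡ fromℕ m + - fromℕ n
    fromℤ-⊖ zero    zero    = sym (trans (+-identityˡ _) -0#≈0#)
    fromℤ-⊖ zero    (suc n) = sym (+-identityˡ _)
    fromℤ-⊖ (suc m) zero    = sym (trans (cong (fromℕ (suc m) +_) -0#≈0#) (+-identityʳ _))
    fromℤ-⊖ (suc m) (suc n) = trans (cong fromℤ (ℤP.[1+m]⊖[1+n]≡m⊖n m n))
                                     (trans (fromℤ-⊖ m n) (sym (cancel-1# _ _)))

    fromℤ-+ : ∀ i j → fromℤ (i ℤ.+ j) ≡ fromℤ i + fromℤ j
    fromℤ-+ (ℤ.+ m)  (ℤ.+ n)  = fromℕ-+ m n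
    fromℤ-+ (ℤ.+ m)  -[1+ n ] = fromℤ-⊖ m (suc n)
    fromℤ-+ -[1+ m ] (ℤ.+ n)  = trans (fromℤ-⊖ n (suc m)) (+-comm _ _)
    fromℤ-+ -[1+ m ] -[1+ n ] = begin
        - fromℕ (suc (suc (m ℕ.+ n)))       ≡⟨ cong (λ z → - fromℕ (suc z)) (sym (ℕP.+-suc m n)) ⟩
        - fromℕ (suc m ℕ.+ suc n)           ≡⟨ cong -_ (fromℕ-+ (suc m) (suc n)) ⟩
        - (fromℕ (suc m) + fromℕ (suc n))   ≡⟨ sym (-‿+-comm _ _) ⟩
        - fromℕ (suc m) + - fromℕ (suc n)   ∎
      where open ≡-Reasoning

    fromℤ-neg : ∀ i → fromℤ (ℤ.- i) ≡ - fromℤ i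
    fromℤ-neg (ℤ.+ zero)  = sym -0#≈0#
    fromℤ-neg (ℤ.+ suc n) = refl
    fromℤ-neg -[1+ n ]    = sym (-‿involutive _)

    almostCommutativeRing : AlmostCommutativeRing _ _
    almostCommutativeRing = fromCommutativeRing commutativeRing

    fromℤ-homomorphism : ℤ.+-*-rawRing -Raw-AlmostCommutative⟶ almostCommutativeRing
    fromℤ-homomorphism = record
      { ⟦_⟧ = fromℤ ; +-homo = fromℤ-+ ; *-homo = fromℤ-* ; -‿homo = fromℤ-neg
      ; 0-homo = refl ; 1-homo = +-identityʳ 1# }

    fromℤ-equal? : ∀ i j → Maybe (fromℤ i ≡ fromℤ j)
    fromℤ-equal? i j with i ℤ.≟ j
    ... | yes i≡j = just (cong fromℤ i≡j)
    ... | no _    = nothing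

  open import Algebra.Solver.Ring ℤ.+-*-rawRing almostCommutativeRing
    fromℤ-homomorphism fromℤ-equal? public

  open IsTotalOrder isTotalOrder public
    using () renaming (trans to ≤-trans; refl to ≤-refl; reflexive to ≤-reflexive;
                      antisym to ≤-antisym; total to ≤-total)

  ≤-poset : Poset _ _ _
  ≤-poset = record { isPartialOrder = IsTotalOrder.isPartialOrder isTotalOrder }

  module ≤-Reasoning = PartialOrderReasoning ≤-poset

  ≤-respʳ-≡ : ∀ {a b c} → a ≤ b → b ≡ c → a ≤ c
  ≤-respʳ-≡ a≤b refl = a≤b

  ≤-respˡ-≡ : ∀ {a b c} → a ≡ b → b ≤ c → a ≤ c
  ≤-respˡ-≡ refl b≤c = b≤c

  x≤y⇒0≤y-x : ∀ {x y} → x ≤ y → 0# ≤ y - x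
  x≤y⇒0≤y-x {x} x≤y = ≤-respˡ-≡ (sym (-‿inverseʳ x)) (+-mono-≤ (- x) x≤y)

  0≤y-x⇒x≤y : ∀ {x y} → 0# ≤ y - x → x ≤ y
  0≤y-x⇒x≤y {x} {y} 0≤y-x = ≤-respʳ-≡ (≤-respˡ-≡ (sym (+-identityˡ x)) (+-mono-≤ x 0≤y-x))
    (solve 2 (λ x y → (y :- x) :+ x := y) refl x y)

  +-nonneg : ∀ {a b} → 0# ≤ a → 0# ≤ b → 0# ≤ a + b
  +-nonneg {a} {b} 0≤a 0≤b = ≤-trans 0≤b (≤-respˡ-≡ (sym (+-identityˡ b)) (+-mono-≤ b 0≤a))

  nonpos⇒neg-nonneg : ∀ {a} → a ≤ 0# → 0# ≤ - a
  nonpos⇒neg-nonneg a≤0 = ≤-respʳ-≡ (x≤y⇒0≤y-x a≤0) (+-identityˡ _)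

  neg-nonneg⇒nonpos : ∀ {a} → 0# ≤ - a → a ≤ 0#
  neg-nonneg⇒nonpos 0≤-a = 0≤y-x⇒x≤y (≤-respʳ-≡ 0≤-a (sym (+-identityˡ _)))

  square-nonneg : ∀ a → 0# ≤ a * a
  square-nonneg a with ≤-total 0# a
  ... | inj₁ 0≤a = *-nonneg 0≤a 0≤a
  ... | inj₂ a≤0 = ≤-respʳ-≡ (*-nonneg (nonpos⇒neg-nonneg a≤0) (nonpos⇒neg-nonneg a≤0))
                             (solve 1 (λ a → (:- a) :* (:- a) := a :* a) refl a)

  0≤1 : 0# ≤ 1#
  0≤1 = ≤-respʳ-≡ (square-nonneg 1#) (*-identityˡ 1#)

  *-cancelˡ-zero : ∀ {a b} → a ≢ 0# → a * b ≡ 0# → b ≡ 0#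
  *-cancelˡ-zero {a} {b} a≢0 ab≡0 = begin
      b                ≡⟨ sym (*-identityˡ b) ⟩
      1# * b           ≡⟨ cong (_* b) (sym (⁻¹-inverse a a≢0)) ⟩
      (a * a ⁻¹) * b   ≡⟨ solve 3 (λ a a⁻¹ b → (a :* a⁻¹) :* b := a⁻¹ :* (a :* b)) refl a (a ⁻¹) b ⟩
      a ⁻¹ * (a * b)   ≡⟨ cong (a ⁻¹ *_) ab≡0 ⟩
      a ⁻¹ * 0#        ≡⟨ zeroʳ _ ⟩
      0#               ∎
    where open ≡-Reasoning

  *-≢0 : ∀ {a b} → a ≢ 0# → b ≢ 0# → a * b ≢ 0#
  *-≢0 a≢0 b≢0 ab≡0 = b≢0 (*-cancelˡ-zero a≢0 ab≡0)

  x-y≡0⇒x≡y : ∀ {x y} → x - y ≡ 0# → x ≡ y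
  x-y≡0⇒x≡y {x} {y} x-y≡0 = begin
      x             ≡⟨ solve 2 (λ x y → x := (x :- y) :+ y) refl x y ⟩
      (x - y) + y   ≡⟨ cong (_+ y) x-y≡0 ⟩
      0# + y        ≡⟨ +-identityˡ y ⟩
      y             ∎
    where open ≡-Reasoning

  nonneg-cancelˡ : ∀ {c a} → 0# ≤ c → c ≢ 0# → 0# ≤ c * a → 0# ≤ a
  nonneg-cancelˡ {c} {a} 0≤c c≢0 0≤ca with ≤-total 0# a
  ... | inj₁ 0≤a = 0≤a
  ... | inj₂ a≤0 = ≤-reflexive (sym (*-cancelˡ-zero c≢0 ca≡0))
    where
      0≤-ca : 0# ≤ - (c * a)
      0≤-ca = ≤-respʳ-≡ (*-nonneg 0≤c (nonpos⇒neg-nonneg a≤0)) (sym (-‿distribʳ-* c a))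
      ca≡0 : c * a ≡ 0#
      ca≡0 = ≤-antisym (neg-nonneg⇒nonpos 0≤-ca) 0≤ca

  *-monoˡ-≤ : ∀ {a b c} → 0# ≤ c → a ≤ b → c * a ≤ c * b
  *-monoˡ-≤ {a} {b} {c} 0≤c a≤b = 0≤y-x⇒x≤y (≤-respʳ-≡ (*-nonneg 0≤c (x≤y⇒0≤y-x a≤b))
    (solve 3 (λ a b c → c :* (b :- a) := c :* b :- c :* a) refl a b c))

  *-cancelˡ-≤ : ∀ {a b c} → 0# ≤ c → c ≢ 0# → c * a ≤ c * b → a ≤ b
  *-cancelˡ-≤ {a} {b} {c} 0≤c c≢0 ca≤cb = 0≤y-x⇒x≤y (nonneg-cancelˡ 0≤c c≢0 (≤-respʳ-≡ (x≤y⇒0≤y-x ca≤cb)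
    (solve 3 (λ a b c → c :* b :- c :* a := c :* (b :- a)) refl a b c)))

  fromℕ-nonneg : ∀ n → 0# ≤ fromℕ n
  fromℕ-nonneg zero    = ≤-refl
  fromℕ-nonneg (suc n) = +-nonneg 0≤1 (fromℕ-nonneg n)

  fromℕ-nonZero : ∀ n → .{{ℕ.NonZero n}} → fromℕ n ≢ 0#
  fromℕ-nonZero (suc n) 1+n≡0 = 0≢1 (≤-antisym 0≤1 (≤-respʳ-≡ 1≤1+n 1+n≡0))
    where
      1≤1+n : 1# ≤ 1# + fromℕ n
      1≤1+n = ≤-respˡ-≡ (sym (+-identityˡ 1#))
                (≤-respʳ-≡ (+-mono-≤ 1# (fromℕ-nonneg n)) (+-comm _ _))

  ⁻¹-nonneg : ∀ {c} → 0# ≤ c → c ≢ 0# → 0# ≤ c ⁻¹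
  ⁻¹-nonneg {c} 0≤c c≢0 = nonneg-cancelˡ 0≤c c≢0 (≤-respʳ-≡ 0≤1 (sym (⁻¹-inverse c c≢0)))

  ⁻¹-unique : ∀ {a b} → a ≢ 0# → a * b ≡ 1# → b ≡ a ⁻¹
  ⁻¹-unique {a} {b} a≢0 ab≡1 = begin
      b                ≡⟨ sym (*-identityʳ b) ⟩
      b * 1#           ≡⟨ cong (b *_) (sym (⁻¹-inverse a a≢0)) ⟩
      b * (a * a ⁻¹)   ≡⟨ solve 3 (λ a a⁻¹ b → b :* (a :* a⁻¹) := (a :* b) :* a⁻¹) refl a (a ⁻¹) b ⟩
      (a * b) * a ⁻¹   ≡⟨ cong (_* a ⁻¹) ab≡1 ⟩
      1# * a ⁻¹        ≡⟨ *-identityˡ _ ⟩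
      a ⁻¹             ∎
    where open ≡-Reasoning

  ≤-divide : ∀ {a b c t} → 0# ≤ c → c ≢ 0# → 0# ≤ t → t ≢ 0# → a ≤ t * b → a * (c * t) ⁻¹ ≤ b * c ⁻¹
  ≤-divide {a} {b} {c} {t} 0≤c c≢0 0≤t t≢0 a≤tb = ≤-respˡ-≡ (*-comm a _)
    (≤-respʳ-≡ (*-monoˡ-≤ (⁻¹-nonneg (*-nonneg 0≤c 0≤t) ct≢0) a≤tb) (begin
      (c * t) ⁻¹ * (t * b)    ≡⟨ solve 4 (λ t b c i → i :* (t :* b) := b :* (t :* i)) refl t b c ((c * t) ⁻¹) ⟩
      b * (t * (c * t) ⁻¹)    ≡⟨ cong (b *_) (⁻¹-unique c≢0 (trans (sym (*-assoc c t _)) (⁻¹-inverse _ ct≢0))) ⟩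
      b * c ⁻¹                ∎))
    where
      open ≡-Reasoning
      ct≢0 : c * t ≢ 0#
      ct≢0 = *-≢0 c≢0 t≢0


  ≤-rescale : ∀ {c e t p q} → 0# ≤ c → c ≢ 0# → 0# ≤ t → c * e ≤ t * p → p ≤ c * q → e ≤ t * q
  ≤-rescale {c} {e} {t} {p} {q} 0≤c c≢0 0≤t ce≤tp p≤cq = *-cancelˡ-≤ 0≤c c≢0 (begin
      c * e          ≤⟨ ce≤tp ⟩
      t * p          ≤⟨ *-monoˡ-≤ 0≤t p≤cq ⟩
      t * (c * q)    ≡⟨ solve 3 (λ t c q → t :* (c :* q) := c :* (t :* q)) refl t c q ⟩
      c * (t * q)    ∎)
    where open ≤-Reasoning

module FiniteSums (F : OrderedField) where
  open OrderedField F
  open FieldArithmetic F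
  open ≡-Reasoning

  Σ-cong : ∀ {n} {f g : Fin n → Carrier} → (∀ i → f i ≡ g i) → Σ[ f ] ≡ Σ[ g ]
  Σ-cong {zero}  f≗g = refl
  Σ-cong {suc n} f≗g = cong₂ _+_ (f≗g zero) (Σ-cong (λ i → f≗g (suc i)))

  Σ-+ : ∀ {n} (f g : Fin n → Carrier) → Σ[ (λ i → f i + g i) ] ≡ Σ[ f ] + Σ[ g ]
  Σ-+ {zero}  f g = sym (+-identityˡ 0#)
  Σ-+ {suc n} f g = trans (cong (f zero + g zero +_) (Σ-+ (λ i → f (suc i)) (λ i → g (suc i))))
     (solve 4 (λ a b c d → (a :+ b) :+ (c :+ d) := (a :+ c) :+ (b :+ d)) refl _ _ _ _)

  Σ-*ˡ : ∀ {n} (c : Carrier) (f : Fin n → Carrier) → Σ[ (λ i → c * f i) ] ≡ c * Σ[ f ]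
  Σ-*ˡ {zero}  c f = sym (zeroʳ c)
  Σ-*ˡ {suc n} c f = trans (cong (c * f zero +_) (Σ-*ˡ c (λ i → f (suc i)))) (sym (distribˡ c _ _))

  Σ-*ʳ : ∀ {n} (c : Carrier) (f : Fin n → Carrier) → Σ[ (λ i → f i * c) ] ≡ Σ[ f ] * c
  Σ-*ʳ c f = trans (Σ-cong (λ i → *-comm (f i) c)) (trans (Σ-*ˡ c f) (*-comm c _))

  Σ-neg : ∀ {n} (f : Fin n → Carrier) → Σ[ (λ i → - f i) ] ≡ - Σ[ f ]
  Σ-neg {zero}  f = sym -0#≈0#
  Σ-neg {suc n} f = trans (cong (- f zero +_) (Σ-neg (λ i → f (suc i)))) (-‿+-comm _ _)

  Σ-- : ∀ {n} (f g : Fin n → Carrier) → Σ[ (λ i → f i - g i) ] ≡ Σ[ f ] - Σ[ g ]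
  Σ-- f g = trans (Σ-+ f (λ i → - g i)) (cong (Σ[ f ] +_) (Σ-neg g))

  Σ-const : ∀ {n} (c : Carrier) → Σ[_] {n} (λ _ → c) ≡ fromℕ n * c
  Σ-const {zero}  c = sym (zeroˡ c)
  Σ-const {suc n} c = begin
      c + Σ[_] {n} (λ _ → c)   ≡⟨ cong (c +_) (Σ-const {n} c) ⟩
      c + fromℕ n * c          ≡⟨ cong (_+ fromℕ n * c) (sym (*-identityˡ c)) ⟩
      1# * c + fromℕ n * c     ≡⟨ sym (distribʳ c 1# (fromℕ n)) ⟩
      (1# + fromℕ n) * c       ∎

  Σ-swap : ∀ {m n} (f : Fin m → Fin n → Carrier) →
           Σ[ (λ i → Σ[ (λ j → f i j) ]) ] ≡ Σ[ (λ j → Σ[ (λ i → f i j) ]) ]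
  Σ-swap {zero}  {n} f = sym (trans (Σ-const {n} 0#) (zeroʳ _))
  Σ-swap {suc m} {n} f = begin
      Σ[ (λ j → f zero j) ] + Σ[ (λ i → Σ[ (λ j → f (suc i) j) ]) ]
        ≡⟨ cong (Σ[ (λ j → f zero j) ] +_) (Σ-swap (λ i j → f (suc i) j)) ⟩
      Σ[ (λ j → f zero j) ] + Σ[ (λ j → Σ[ (λ i → f (suc i) j) ]) ]
        ≡⟨ sym (Σ-+ (λ j → f zero j) _) ⟩
      Σ[ (λ j → f zero j + Σ[ (λ i → f (suc i) j) ]) ] ∎

  Σ-nonneg : ∀ {n} (f : Fin n → Carrier) → (∀ i → 0# ≤ f i) → 0# ≤ Σ[ f ]
  Σ-nonneg {zero}  f 0≤f = ≤-refl
  Σ-nonneg {suc n} f 0≤f = +-nonneg (0≤f zero) (Σ-nonneg (λ i → f (suc i)) (λ i → 0≤f (suc i)))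

  indicator : Bool → Carrier
  indicator b = if b then 1# else 0#

  indicator-∧ : ∀ a b → indicator a * indicator b ≡ indicator (a ∧ b)
  indicator-∧ true  b = *-identityˡ _
  indicator-∧ false b = zeroˡ _

  indicator-idem : ∀ a → indicator a * indicator a ≡ indicator a
  indicator-idem a = trans (indicator-∧ a a) (cong indicator (∧-idem a))

  count-as-Σ : ∀ {n} (p : Fin n → Bool) → fromℕ (count p) ≡ Σ[ (λ i → indicator (p i)) ]
  count-as-Σ {zero}  p = refl
  count-as-Σ {suc n} p with p zero
  ... | true  = cong (1# +_) (count-as-Σ (λ i → p (suc i)))
  ... | false = trans (count-as-Σ (λ i → p (suc i))) (sym (+-identityˡ _))

  sumℕ-as-Σ : ∀ {n} (f : Fin n → ℕ) → fromℕ (sumℕ f) ≡ Σ[ (λ i → fromℕ (f i)) ]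
  sumℕ-as-Σ {zero}  f = refl
  sumℕ-as-Σ {suc n} f = trans (fromℕ-+ (f zero) _) (cong (fromℕ (f zero) +_) (sumℕ-as-Σ (λ i → f (suc i))))

  δ : ∀ {n} → Fin n → Fin n → Carrier
  δ i j = indicator (does (i Fin.≟ j))

  δ-Σ : ∀ {n} (i : Fin n) (w : Fin n → Carrier) → Σ[ (λ j → δ i j * w j) ] ≡ w i
  δ-Σ {suc n} zero w = begin
      1# * w zero + Σ[ (λ j → 0# * w (suc j)) ]  ≡⟨ cong₂ _+_ (*-identityˡ _) (trans (Σ-*ˡ {n} 0# _) (zeroˡ _)) ⟩
      w zero + 0#                                ≡⟨ +-identityʳ _ ⟩
      w zero                                     ∎
  δ-Σ {suc n} (suc i) w = trans (cong₂ _+_ (zeroˡ (w zero)) (δ-Σ i (λ j → w (suc j)))) (+-identityˡ _)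


module AdjacencyOperator (F : OrderedField) {v : ℕ} (G : Graph v) where
  open OrderedField F
  open FieldArithmetic F
  open FiniteSums F
  open ≡-Reasoning

  Vector : Set
  Vector = Fin v → Carrier

  ⟨_,_⟩ : Vector → Vector → Carrier
  ⟨ u , w ⟩ = Σ[ (λ i → u i * w i) ]

  A· : Vector → Vector
  A· w i = Σ[ (λ j → A G F i j * w j) ]

  ⟨⟩-comm : ∀ u w → ⟨ u , w ⟩ ≡ ⟨ w , u ⟩
  ⟨⟩-comm u w = Σ-cong {v} (λ i → *-comm (u i) (w i))

  ⟨⟩-affineˡ : ∀ a b u w → ⟨ (λ i → a * u i - b) , w ⟩ ≡ a * ⟨ u , w ⟩ - b * Σ[ w ]
  ⟨⟩-affineˡ a b u w = begin
      ⟨ (λ i → a * u i - b) , w ⟩                   ≡⟨ Σ-cong {v} (λ i → solve 4 (λ a b u w →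
                                                         (a :* u :- b) :* w := a :* (u :* w) :- b :* w) refl a b (u i) (w i)) ⟩
      Σ[ (λ i → a * (u i * w i) - b * w i) ]        ≡⟨ Σ-- {v} _ _ ⟩
      Σ[ (λ i → a * (u i * w i)) ] - Σ[ (λ i → b * w i) ]
                                                    ≡⟨ cong₂ _-_ (Σ-*ˡ {v} a _) (Σ-*ˡ {v} b w) ⟩
      a * ⟨ u , w ⟩ - b * Σ[ w ]                    ∎

  A·-self-adjoint : ∀ u w → ⟨ u , A· w ⟩ ≡ ⟨ A· u , w ⟩
  A·-self-adjoint u w = begin
      Σ[ (λ i → u i * Σ[ (λ j → A G F i j * w j) ]) ]    ≡⟨ Σ-cong {v} (λ i → sym (Σ-*ˡ {v} (u i) _)) ⟩
      Σ[ (λ i → Σ[ (λ j → u i * (A G F i j * w j)) ]) ]  ≡⟨ Σ-swap {v} {v} _ ⟩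
      Σ[ (λ j → Σ[ (λ i → u i * (A G F i j * w j)) ]) ]  ≡⟨ Σ-cong {v} (λ j → Σ-cong {v} (λ i → reorder i j)) ⟩
      Σ[ (λ j → Σ[ (λ i → A G F j i * u i * w j) ]) ]    ≡⟨ Σ-cong {v} (λ j → Σ-*ʳ {v} (w j) _) ⟩
      Σ[ (λ j → Σ[ (λ i → A G F j i * u i) ] * w j) ]    ∎
    where
      reorder : ∀ i j → u i * (A G F i j * w j) ≡ A G F j i * u i * w j
      reorder i j = trans (solve 3 (λ a b c → a :* (b :* c) := (b :* a) :* c) refl (u i) (A G F i j) (w j))
                          (cong (λ a → a * u i * w j) (cong indicator (Graph.sym G i j)))

  A·-cong : ∀ {f g} → (∀ j → f j ≡ g j) → ∀ i → A· f i ≡ A· g i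
  A·-cong f≗g i = Σ-cong {v} (λ j → cong (A G F i j *_) (f≗g j))

  A·-- : ∀ f g i → A· (λ j → f j - g j) i ≡ A· f i - A· g i
  A·-- f g i = trans (Σ-cong {v} (λ j → solve 3 (λ a f g → a :* (f :- g) := a :* f :- a :* g) refl (A G F i j) (f j) (g j)))
                     (Σ-- {v} _ _)

  A·-* : ∀ a f i → A· (λ j → a * f j) i ≡ a * A· f i
  A·-* a f i = trans (Σ-cong {v} (λ j → solve 3 (λ m a f → m :* (a :* f) := a :* (m :* f)) refl (A G F i j) a (f j)))
                     (Σ-*ˡ {v} a _)

  row-sum : ∀ i → Σ[ A G F i ] ≡ fromℕ (deg G i)
  row-sum i = sym (count-as-Σ {v} (adj G i))

  A·-const : ∀ c i → A· (λ _ → c) i ≡ fromℕ (deg G i) * c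
  A·-const c i = trans (Σ-*ʳ {v} c (A G F i)) (cong (_* c) (row-sum i))

  A²-entries : ∀ w x → A· (A· w) x ≡ Σ[ (λ z → fromℕ (commonNbrs G x z) * w z) ]
  A²-entries w x = begin
      Σ[ (λ y → A G F x y * Σ[ (λ z → A G F y z * w z) ]) ]     ≡⟨ Σ-cong {v} (λ y → sym (Σ-*ˡ {v} (A G F x y) _)) ⟩
      Σ[ (λ y → Σ[ (λ z → A G F x y * (A G F y z * w z)) ]) ]   ≡⟨ Σ-swap {v} {v} _ ⟩
      Σ[ (λ z → Σ[ (λ y → A G F x y * (A G F y z * w z)) ]) ]   ≡⟨ Σ-cong {v} (λ z → trans (Σ-cong {v} (λ y → sym (*-assoc _ _ _)))
                                                                                         (Σ-*ʳ {v} (w z) _)) ⟩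
      Σ[ (λ z → Σ[ (λ y → A G F x y * A G F y z) ] * w z) ]     ≡⟨ Σ-cong {v} (λ z → cong (_* w z) common) ⟩
      Σ[ (λ z → fromℕ (commonNbrs G x z) * w z) ]               ∎
    where
      common : ∀ {z} → Σ[ (λ y → A G F x y * A G F y z) ] ≡ fromℕ (commonNbrs G x z)
      common {z} = trans (Σ-cong {v} (λ y → indicator-∧ (adj G x y) (adj G y z))) (sym (count-as-Σ {v} _))

  -- A is self-adjoint, so eigenvectors for distinct eigenvalues are orthogonal
  eigenvectors-orthogonal : ∀ {a b u w} → a ≢ b →
    (∀ i → A· u i ≡ a * u i) → (∀ i → A· w i ≡ b * w i) → ⟨ u , w ⟩ ≡ 0#
  eigenvectors-orthogonal {a} {b} {u} {w} a≢b Au≡au Aw≡bw =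
    *-cancelˡ-zero (λ a-b≡0 → a≢b (x-y≡0⇒x≡y a-b≡0)) (begin
      (a - b) * ⟨ u , w ⟩                  ≡⟨ solve 3 (λ a b I → (a :- b) :* I := a :* I :- b :* I) refl a b ⟨ u , w ⟩ ⟩
      a * ⟨ u , w ⟩ - b * ⟨ u , w ⟩        ≡⟨ cong₂ _-_ (sym (Σ-*ˡ {v} a _)) (sym (Σ-*ˡ {v} b _)) ⟩
      Σ[ (λ i → a * (u i * w i)) ] - Σ[ (λ i → b * (u i * w i)) ]
                                           ≡⟨ cong₂ _-_ (Σ-cong {v} (λ i → trans (sym (*-assoc a (u i) (w i))) (cong (_* w i) (sym (Au≡au i)))))
                                                        (Σ-cong {v} (λ i → trans (*-swap b (u i) (w i)) (cong (u i *_) (sym (Aw≡bw i))))) ⟩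
      ⟨ A· u , w ⟩ - ⟨ u , A· w ⟩          ≡⟨ cong (λ r → ⟨ A· u , w ⟩ - r) (A·-self-adjoint u w) ⟩
      ⟨ A· u , w ⟩ - ⟨ A· u , w ⟩          ≡⟨ -‿inverseʳ _ ⟩
      0#                                   ∎)
    where
      *-swap : ∀ c p q → c * (p * q) ≡ p * (c * q)
      *-swap c p q = solve 3 (λ c p q → c :* (p :* q) := p :* (c :* q)) refl c p q

module RegularCuts (F : OrderedField) {v : ℕ} (G : Graph v) (k : ℕ)
    (regular : ∀ x → deg G x ≡ k) (S : VSubset G) where
  open OrderedField F
  open FieldArithmetic F
  open FiniteSums F
  open AdjacencyOperator F G
  open ≡-Reasoning

  K T : Carrier
  K = fromℕ k
  T = fromℕ (size G S)

  s : Vector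
  s i = indicator (S i)

  Σ-s : Σ[ s ] ≡ T
  Σ-s = sym (count-as-Σ {v} S)

  ⟨s,s⟩ : ⟨ s , s ⟩ ≡ T
  ⟨s,s⟩ = trans (Σ-cong {v} (λ i → indicator-idem (S i))) Σ-s

  Σ-s*K : Σ[ (λ i → s i * K) ] ≡ K * T
  Σ-s*K = trans (Σ-*ʳ {v} K s) (trans (cong (_* K) Σ-s) (*-comm T K))

  vol-regular : fromℕ (vol G S) ≡ K * T
  vol-regular = trans (sumℕ-as-Σ {v} _) (trans (Σ-cong {v} degree-term) Σ-s*K)
    where
      degree-term : ∀ i → fromℕ (if S i then deg G i else 0) ≡ s i * K
      degree-term i with S i
      ... | true  = trans (cong fromℕ (regular i)) (sym (*-identityˡ K))
      ... | false = sym (zeroˡ K)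

  -- an edge leaving x ∈ S either leaves S or stays inside it
  edge-split : ∀ a b c → indicator (a ∧ not b ∧ c) + indicator a * (indicator c * indicator b)
                         ≡ indicator a * indicator c
  edge-split false b     c     = trans (+-identityˡ _) (trans (zeroˡ _) (sym (zeroˡ _)))
  edge-split true  true  true  = trans (+-identityˡ _) (cong (1# *_) (*-identityʳ _))
  edge-split true  true  false = trans (+-identityˡ _) (cong (1# *_) (zeroˡ _))
  edge-split true  false true  = trans (cong (1# +_) (trans (*-identityˡ _) (zeroʳ _))) (trans (+-identityʳ _) (sym (*-identityˡ _)))
  edge-split true  false false = trans (+-identityˡ _) (cong (1# *_) (zeroˡ _))

  edges-out : fromℕ (edgesOut G S) + ⟨ s , A· s ⟩ ≡ K * T
  edges-out = begin
      fromℕ (edgesOut G S) + ⟨ s , A· s ⟩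
        ≡⟨ cong₂ _+_ (trans (sumℕ-as-Σ {v} _) (Σ-cong {v} (λ i → count-as-Σ {v} _)))
                     (Σ-cong {v} (λ i → sym (Σ-*ˡ {v} (s i) _))) ⟩
      Σ[ (λ i → Σ[ (λ j → out i j) ]) ] + Σ[ (λ i → Σ[ (λ j → s i * (A G F i j * s j)) ]) ]
        ≡⟨ trans (sym (Σ-+ {v} _ _)) (Σ-cong {v} (λ i → sym (Σ-+ {v} _ _))) ⟩
      Σ[ (λ i → Σ[ (λ j → out i j + s i * (A G F i j * s j)) ]) ]
        ≡⟨ Σ-cong {v} (λ i → Σ-cong {v} (λ j → edge-split (S i) (S j) (adj G i j))) ⟩
      Σ[ (λ i → Σ[ (λ j → s i * A G F i j) ]) ]
        ≡⟨ Σ-cong {v} (λ i → trans (Σ-*ˡ {v} (s i) _) (cong (s i *_) (trans (row-sum i) (cong fromℕ (regular i))))) ⟩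
      Σ[ (λ i → s i * K) ]
        ≡⟨ Σ-s*K ⟩
      K * T ∎
    where
      out : Fin v → Fin v → Carrier
      out i j = indicator (S i ∧ not (S j) ∧ adj G i j)

module StronglyRegularAlgebra (F : OrderedField) {v : ℕ} (G : Graph v) (k : ℕ)
    (regular : ∀ x → deg G x ≡ k) (λ′ μ : ℕ)
    (adjacent-common : ∀ x y → adj G x y ≡ true → commonNbrs G x y ≡ λ′)
    (nonadjacent-common : ∀ x y → x ≢ y → adj G x y ≡ false → commonNbrs G x y ≡ μ) where
  open OrderedField F
  open FieldArithmetic F
  open FiniteSums F
  open AdjacencyOperator F G
  open ≡-Reasoning

  K M P R : Carrier
  K = fromℕ k
  M = fromℕ μ
  P = fromℕ λ′ - M
  R = K - M

  -- the all-ones vector is an eigenvector for k, so A preserves sums up to k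
  Σ-A· : ∀ w → Σ[ A· w ] ≡ K * Σ[ w ]
  Σ-A· w = begin
      Σ[ A· w ]                    ≡⟨ Σ-cong {v} (λ i → sym (*-identityˡ _)) ⟩
      ⟨ (λ _ → 1#) , A· w ⟩        ≡⟨ A·-self-adjoint _ w ⟩
      ⟨ A· (λ _ → 1#) , w ⟩        ≡⟨ Σ-cong {v} (λ i → cong (_* w i) (A·𝟙 i)) ⟩
      Σ[ (λ i → K * 1# * w i) ]    ≡⟨ Σ-cong {v} (λ i → cong (_* w i) (*-identityʳ K)) ⟩
      Σ[ (λ i → K * w i) ]         ≡⟨ Σ-*ˡ {v} K w ⟩
      K * Σ[ w ]                   ∎
    where
      A·𝟙 : ∀ i → A· (λ _ → 1#) i ≡ K * 1#
      A·𝟙 i = trans (A·-const 1# i) (cong (λ d → fromℕ d * 1#) (regular i))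

  common-neighbours : ∀ x z → fromℕ (commonNbrs G x z) ≡ M + R * δ x z + P * A G F x z
  common-neighbours x z with x Fin.≟ z
  ... | yes refl = begin
      fromℕ (commonNbrs G x x)      ≡⟨ cong fromℕ (trans (count-cong own-neighbours) (regular x)) ⟩
      K                             ≡⟨ solve 2 (λ K M → K := M :+ (K :- M) :+ con (ℤ.+ 0)) refl K M ⟩
      M + R + 0#                    ≡⟨ cong₂ (λ a b → M + a + b) (sym (*-identityʳ R)) (sym (zeroʳ P)) ⟩
      M + R * 1# + P * 0#           ≡⟨ cong (λ b → M + R * 1# + P * indicator b) (sym (Graph.irrefl G x)) ⟩
      M + R * 1# + P * A G F x x    ∎
    where
      own-neighbours : ∀ y → (adj G x y ∧ adj G y x) ≡ adj G x y
      own-neighbours y = trans (cong (adj G x y ∧_) (Graph.sym G y x)) (∧-idem _)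
      count-cong : ∀ {n} {p q : Fin n → Bool} → (∀ i → p i ≡ q i) → count p ≡ count q
      count-cong {zero}  p≗q = refl
      count-cong {suc n} p≗q = cong₂ (λ b c → (if b then 1 else 0) ℕ.+ c) (p≗q zero) (count-cong (λ i → p≗q (suc i)))
  ... | no x≢z with adj G x z in x∼z?
  ...   | true = begin
      fromℕ (commonNbrs G x z)      ≡⟨ cong fromℕ (adjacent-common x z x∼z?) ⟩
      fromℕ λ′                      ≡⟨ solve 2 (λ L M → L := M :+ con (ℤ.+ 0) :+ (L :- M)) refl (fromℕ λ′) M ⟩
      M + 0# + P                    ≡⟨ cong₂ (λ a b → M + a + b) (sym (zeroʳ R)) (sym (*-identityʳ P)) ⟩
      M + R * 0# + P * 1#           ∎
  ...   | false = begin
      fromℕ (commonNbrs G x z)      ≡⟨ cong fromℕ (nonadjacent-common x z x≢z x∼z?) ⟩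
      M                             ≡⟨ solve 1 (λ M → M := M :+ con (ℤ.+ 0) :+ con (ℤ.+ 0)) refl M ⟩
      M + 0# + 0#                   ≡⟨ cong₂ (λ a b → M + a + b) (sym (zeroʳ R)) (sym (zeroʳ P)) ⟩
      M + R * 0# + P * 0#           ∎

  A²-on-sum-zero : ∀ w → Σ[ w ] ≡ 0# → ∀ x → A· (A· w) x ≡ R * w x + P * A· w x
  A²-on-sum-zero w Σw≡0 x = begin
      A· (A· w) x                                             ≡⟨ A²-entries w x ⟩
      Σ[ (λ z → fromℕ (commonNbrs G x z) * w z) ]             ≡⟨ Σ-cong {v} (λ z → trans (cong (_* w z) (common-neighbours x z))
                                                                   (solve 6 (λ M R P d a w → (M :+ R :* d :+ P :* a) :* w
                                                                     := M :* w :+ (R :* (d :* w) :+ P :* (a :* w)))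
                                                                     refl M R P (δ x z) (A G F x z) (w z))) ⟩
      Σ[ (λ z → M * w z + (R * (δ x z * w z) + P * (A G F x z * w z))) ]
                                                              ≡⟨ trans (Σ-+ {v} _ _) (cong₂ _+_ (Σ-*ˡ {v} M w) (Σ-+ {v} _ _)) ⟩
      M * Σ[ w ] + (Σ[ (λ z → R * (δ x z * w z)) ] + Σ[ (λ z → P * (A G F x z * w z)) ])
                                                              ≡⟨ cong₂ (λ a b → M * a + b) Σw≡0
                                                                   (cong₂ _+_ (Σ-*ˡ {v} R _) (Σ-*ˡ {v} P _)) ⟩
      M * 0# + (R * Σ[ (λ z → δ x z * w z) ] + P * A· w x)    ≡⟨ cong₂ (λ a b → a + (R * b + P * A· w x)) (zeroʳ M) (δ-Σ x w) ⟩
      0# + (R * w x + P * A· w x)                             ≡⟨ +-identityˡ _ ⟩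
      R * w x + P * A· w x                                    ∎

  -- an eigenvector for θ ≠ k sums to zero, so its eigenvalue satisfies the quadratic
  eigenvalue-quadratic : ∀ θ → IsEigenvalue G F θ → θ ≢ K → θ * θ ≡ P * θ + R
  eigenvalue-quadratic θ (w , (i , wᵢ≢0) , Aw≡θw) θ≢K =
    x-y≡0⇒x≡y (*-cancelˡ-zero wᵢ≢0 (trans (*-comm _ _) (begin
      (θ * θ - (P * θ + R)) * w i                  ≡⟨ solve 4 (λ θ P R x → (θ :* θ :- (P :* θ :+ R)) :* x
                                                         := θ :* (θ :* x) :- (R :* x :+ P :* (θ :* x))) refl θ P R (w i) ⟩
      θ * (θ * w i) - (R * w i + P * (θ * w i))    ≡⟨ cong₂ (λ a b → a - (R * w i + P * b)) (sym A²w) (sym (Aw≡θw i)) ⟩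
      A· (A· w) i - (R * w i + P * A· w i)         ≡⟨ cong (_- (R * w i + P * A· w i)) (A²-on-sum-zero w Σw≡0 i) ⟩
      (R * w i + P * A· w i) - (R * w i + P * A· w i) ≡⟨ -‿inverseʳ _ ⟩
      0#                                           ∎)))
    where
      Σw≡0 : Σ[ w ] ≡ 0#
      Σw≡0 = *-cancelˡ-zero (λ K-θ≡0 → θ≢K (sym (x-y≡0⇒x≡y K-θ≡0))) (begin
          (K - θ) * Σ[ w ]                     ≡⟨ solve 3 (λ K θ s → (K :- θ) :* s := K :* s :- θ :* s) refl K θ (Σ[ w ]) ⟩
          K * Σ[ w ] - θ * Σ[ w ]              ≡⟨ cong₂ _-_ (sym (Σ-A· w)) (sym (Σ-*ˡ {v} θ w)) ⟩
          Σ[ A· w ] - Σ[ (λ j → θ * w j) ]     ≡⟨ cong (_- Σ[ (λ j → θ * w j) ]) (Σ-cong {v} Aw≡θw) ⟩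
          Σ[ (λ j → θ * w j) ] - Σ[ (λ j → θ * w j) ] ≡⟨ -‿inverseʳ _ ⟩
          0#                                   ∎)
      A²w : A· (A· w) i ≡ θ * (θ * w i)
      A²w = trans (A·-cong Aw≡θw i) (trans (A·-* θ w i) (cong (θ *_) (Aw≡θw i)))

  shift : Carrier → Vector → Vector
  shift θ x i = A· x i - θ * x i

  -- if a, b are the roots of the quadratic, then (A − a)(A − b) vanishes on
  -- vectors summing to zero: (A − b) x is an a-eigenvector
  shift-eigenvector : ∀ {a b} → P ≡ a + b → R ≡ - (a * b) →
    ∀ x → Σ[ x ] ≡ 0# → ∀ i → A· (shift b x) i ≡ a * shift b x i
  shift-eigenvector {a} {b} P≡a+b R≡-ab x Σx≡0 i = begin
      A· (shift b x) i                       ≡⟨ A·-- (A· x) (λ j → b * x j) i ⟩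
      A· (A· x) i - A· (λ j → b * x j) i     ≡⟨ cong₂ _-_ (A²-on-sum-zero x Σx≡0 i) (A·-* b x i) ⟩
      (R * x i + P * A· x i) - b * A· x i    ≡⟨ cong₂ (λ r p → (r * x i + p * A· x i) - b * A· x i) R≡-ab P≡a+b ⟩
      (- (a * b) * x i + (a + b) * A· x i) - b * A· x i
                                             ≡⟨ solve 4 (λ a b u Au → (:- (a :* b) :* u :+ (a :+ b) :* Au) :- b :* Au
                                                   := a :* (Au :- b :* u)) refl a b (x i) (A· x i) ⟩
      a * shift b x i                        ∎

  module Spectrum (θ₁ θ₂ : Carrier) (ev₁ : IsEigenvalue G F θ₁) (ev₂ : IsEigenvalue G F θ₂)
                  (θ₁<K : θ₁ < K) (θ₂<θ₁ : θ₂ < θ₁) where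

    θ₂≢θ₁ : θ₂ ≢ θ₁
    θ₂≢θ₁ = proj₂ θ₂<θ₁

    θ₁-root : θ₁ * θ₁ ≡ P * θ₁ + R
    θ₁-root = eigenvalue-quadratic θ₁ ev₁ (proj₂ θ₁<K)

    θ₂-root : θ₂ * θ₂ ≡ P * θ₂ + R
    θ₂-root = eigenvalue-quadratic θ₂ ev₂ (λ θ₂≡K → proj₂ θ₁<K
      (≤-antisym (proj₁ θ₁<K) (≤-respˡ-≡ (sym θ₂≡K) (proj₁ θ₂<θ₁))))

    roots-sum : P ≡ θ₁ + θ₂
    roots-sum = sym (x-y≡0⇒x≡y (*-cancelˡ-zero (λ d≡0 → θ₂≢θ₁ (sym (x-y≡0⇒x≡y d≡0))) (begin
        (θ₁ - θ₂) * (θ₁ + θ₂ - P)                          ≡⟨ solve 3 (λ a b P → (a :- b) :* (a :+ b :- P)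
                                                                 := (a :* a :- b :* b) :- P :* (a :- b)) refl θ₁ θ₂ P ⟩
        (θ₁ * θ₁ - θ₂ * θ₂) - P * (θ₁ - θ₂)                ≡⟨ cong₂ (λ p q → (p - q) - P * (θ₁ - θ₂)) θ₁-root θ₂-root ⟩
        ((P * θ₁ + R) - (P * θ₂ + R)) - P * (θ₁ - θ₂)      ≡⟨ solve 4 (λ a b P R → ((P :* a :+ R) :- (P :* b :+ R)) :- P :* (a :- b)
                                                                 := con (ℤ.+ 0)) refl θ₁ θ₂ P R ⟩
        0#                                                 ∎)))

    roots-product : R ≡ - (θ₁ * θ₂)
    roots-product = begin
        R                             ≡⟨ solve 3 (λ a P R → R := (P :* a :+ R) :- P :* a) refl θ₁ P R ⟩
        (P * θ₁ + R) - P * θ₁         ≡⟨ cong₂ (λ s p → s - p * θ₁) (sym θ₁-root) roots-sum ⟩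
        θ₁ * θ₁ - (θ₁ + θ₂) * θ₁      ≡⟨ solve 2 (λ a b → a :* a :- (a :+ b) :* a := :- (a :* b)) refl θ₁ θ₂ ⟩
        - (θ₁ * θ₂)                   ∎

    -- A − θ₂ is positive semidefinite on vectors summing to zero: writing
    -- (θ₁ − θ₂) x = y − z with y = (A − θ₂) x, z = (A − θ₁) x eigenvectors for
    -- θ₁ and θ₂, one gets (θ₁ − θ₂) ⟨x, y⟩ = ⟨y, y⟩ − ⟨y, z⟩ = ⟨y, y⟩ ≥ 0.
    smallest-eigenvalue-bound : ∀ x → Σ[ x ] ≡ 0# → θ₂ * ⟨ x , x ⟩ ≤ ⟨ x , A· x ⟩
    smallest-eigenvalue-bound x Σx≡0 = 0≤y-x⇒x≤y (≤-respʳ-≡ 0≤⟨x,y⟩ ⟨x,y⟩-expanded)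
      where
        y z : Vector
        y = shift θ₂ x
        z = shift θ₁ x

        ⟨y,z⟩≡0 : ⟨ y , z ⟩ ≡ 0#
        ⟨y,z⟩≡0 = eigenvectors-orthogonal (λ θ₁≡θ₂ → θ₂≢θ₁ (sym θ₁≡θ₂))
          (shift-eigenvector roots-sum roots-product x Σx≡0)
          (shift-eigenvector (trans roots-sum (+-comm θ₁ θ₂)) (trans roots-product (cong -_ (*-comm θ₁ θ₂))) x Σx≡0)

        d⟨x,y⟩≡⟨y,y⟩ : (θ₁ - θ₂) * ⟨ x , y ⟩ ≡ ⟨ y , y ⟩
        d⟨x,y⟩≡⟨y,y⟩ = begin
            (θ₁ - θ₂) * ⟨ x , y ⟩                    ≡⟨ sym (Σ-*ˡ {v} _ _) ⟩
            Σ[ (λ i → (θ₁ - θ₂) * (x i * y i)) ]     ≡⟨ Σ-cong {v} (λ i → solve 4 (λ a b u Au →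
                                                           (a :- b) :* (u :* (Au :- b :* u))
                                                           := (Au :- b :* u) :* (Au :- b :* u) :- (Au :- b :* u) :* (Au :- a :* u))
                                                           refl θ₁ θ₂ (x i) (A· x i)) ⟩
            Σ[ (λ i → y i * y i - y i * z i) ]       ≡⟨ Σ-- {v} _ _ ⟩
            ⟨ y , y ⟩ - ⟨ y , z ⟩                    ≡⟨ cong (λ r → ⟨ y , y ⟩ - r) ⟨y,z⟩≡0 ⟩
            ⟨ y , y ⟩ - 0#                           ≡⟨ trans (cong (⟨ y , y ⟩ +_) -0#≈0#) (+-identityʳ _) ⟩
            ⟨ y , y ⟩                                ∎

        0≤⟨x,y⟩ : 0# ≤ ⟨ x , y ⟩
        0≤⟨x,y⟩ = nonneg-cancelˡ (x≤y⇒0≤y-x (proj₁ θ₂<θ₁)) (λ d≡0 → θ₂≢θ₁ (sym (x-y≡0⇒x≡y d≡0)))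
          (≤-respʳ-≡ (Σ-nonneg {v} _ (λ i → square-nonneg (y i))) (sym d⟨x,y⟩≡⟨y,y⟩))

        ⟨x,y⟩-expanded : ⟨ x , y ⟩ ≡ ⟨ x , A· x ⟩ - θ₂ * ⟨ x , x ⟩
        ⟨x,y⟩-expanded = begin
            Σ[ (λ i → x i * (A· x i - θ₂ * x i)) ]               ≡⟨ Σ-cong {v} (λ i → solve 3 (λ u Au b →
                                                                     u :* (Au :- b :* u) := u :* Au :- b :* (u :* u)) refl (x i) (A· x i) θ₂) ⟩
            Σ[ (λ i → x i * A· x i - θ₂ * (x i * x i)) ]         ≡⟨ Σ-- {v} _ _ ⟩
            ⟨ x , A· x ⟩ - Σ[ (λ i → θ₂ * (x i * x i)) ]         ≡⟨ cong (λ r → ⟨ x , A· x ⟩ - r) (Σ-*ˡ {v} θ₂ _) ⟩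
            ⟨ x , A· x ⟩ - θ₂ * ⟨ x , x ⟩                        ∎

    -- the graph is nonempty, since it has an eigenvector
    V≢0 : fromℕ v ≢ 0#
    V≢0 = fromℕ-nonZero v {{Fin.nonZeroIndex (proj₁ (proj₁ (proj₂ ev₁)))}}

    -- Test the bound on x = v·𝟙_S − |S|·𝟙, which sums to zero:
    -- ⟨x, x⟩ = v |S| (v − |S|) and ⟨x, A x⟩ = v (v (k|S| − E[S,Sᶜ]) − k|S|²),
    -- which gives  v · E[S,Sᶜ] ≤ |S| (v − |S|) (k − θ₂).
    cut-bound : ∀ S → fromℕ v * fromℕ (edgesOut G S)
                      ≤ fromℕ (size G S) * (fromℕ v - fromℕ (size G S)) * (K - θ₂)
    cut-bound S = 0≤y-x⇒x≤y (nonneg-cancelˡ (fromℕ-nonneg v) V≢0 (≤-respʳ-≡ (x≤y⇒0≤y-x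
                    (smallest-eigenvalue-bound x Σx≡0)) quadratic-form))
      where
        open RegularCuts F G k regular S using (T; s; Σ-s; ⟨s,s⟩; edges-out)
        V Es : Carrier
        V = fromℕ v
        Es = fromℕ (edgesOut G S)

        x : Vector
        x i = V * s i - T

        Σx≡0 : Σ[ x ] ≡ 0#
        Σx≡0 = begin
            Σ[ x ]                                   ≡⟨ Σ-- {v} _ _ ⟩
            Σ[ (λ i → V * s i) ] - Σ[_] {v} (λ _ → T) ≡⟨ cong₂ _-_ (Σ-*ˡ {v} V s) (Σ-const {v} T) ⟩
            V * Σ[ s ] - V * T                       ≡⟨ cong (λ r → V * r - V * T) Σ-s ⟩
            V * T - V * T                            ≡⟨ -‿inverseʳ _ ⟩
            0#                                       ∎

        ⟨x,x⟩ : ⟨ x , x ⟩ ≡ V * (V * T - T * T)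
        ⟨x,x⟩ = begin
            ⟨ x , x ⟩                        ≡⟨ ⟨⟩-affineˡ V T s x ⟩
            V * ⟨ s , x ⟩ - T * Σ[ x ]       ≡⟨ cong₂ (λ p q → V * p - T * q) (⟨⟩-comm s x) Σx≡0 ⟩
            V * ⟨ x , s ⟩ - T * 0#           ≡⟨ cong (λ p → V * p - T * 0#) (⟨⟩-affineˡ V T s s) ⟩
            V * (V * ⟨ s , s ⟩ - T * Σ[ s ]) - T * 0#
                                             ≡⟨ cong₂ (λ p q → V * (V * p - T * q) - T * 0#) ⟨s,s⟩ Σ-s ⟩
            V * (V * T - T * T) - T * 0#     ≡⟨ solve 2 (λ V T → V :* (V :* T :- T :* T) :- T :* con (ℤ.+ 0)
                                                  := V :* (V :* T :- T :* T)) refl V T ⟩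
            V * (V * T - T * T)              ∎

        ⟨x,Ax⟩ : ⟨ x , A· x ⟩ ≡ V * (V * (K * T - Es) - T * (K * T))
        ⟨x,Ax⟩ = begin
            ⟨ x , A· x ⟩                                 ≡⟨ ⟨⟩-affineˡ V T s (A· x) ⟩
            V * ⟨ s , A· x ⟩ - T * Σ[ A· x ]             ≡⟨ cong₂ (λ p q → V * p - T * q)
                                                              (trans (A·-self-adjoint s x) (⟨⟩-comm _ x))
                                                              (trans (Σ-A· x) (cong (K *_) Σx≡0)) ⟩
            V * ⟨ x , A· s ⟩ - T * (K * 0#)              ≡⟨ cong (λ p → V * p - T * (K * 0#)) (⟨⟩-affineˡ V T s (A· s)) ⟩
            V * (V * ⟨ s , A· s ⟩ - T * Σ[ A· s ]) - T * (K * 0#)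
                                                         ≡⟨ cong₂ (λ p q → V * (V * p - T * q) - T * (K * 0#))
                                                              ⟨s,As⟩ (trans (Σ-A· s) (cong (K *_) Σ-s)) ⟩
            V * (V * (K * T - Es) - T * (K * T)) - T * (K * 0#)
                                                         ≡⟨ solve 4 (λ V T K E → V :* (V :* (K :* T :- E) :- T :* (K :* T)) :- T :* (K :* con (ℤ.+ 0))
                                                              := V :* (V :* (K :* T :- E) :- T :* (K :* T))) refl V T K Es ⟩
            V * (V * (K * T - Es) - T * (K * T))         ∎
          where
            ⟨s,As⟩ : ⟨ s , A· s ⟩ ≡ K * T - Es
            ⟨s,As⟩ = trans (solve 2 (λ e E → e := (E :+ e) :- E) refl ⟨ s , A· s ⟩ Es) (cong (_- Es) edges-out)

        quadratic-form : ⟨ x , A· x ⟩ - θ₂ * ⟨ x , x ⟩ ≡ V * (T * (V - T) * (K - θ₂) - V * Es)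
        quadratic-form = begin
            ⟨ x , A· x ⟩ - θ₂ * ⟨ x , x ⟩                                  ≡⟨ cong₂ (λ p q → p - θ₂ * q) ⟨x,Ax⟩ ⟨x,x⟩ ⟩
            V * (V * (K * T - Es) - T * (K * T)) - θ₂ * (V * (V * T - T * T)) ≡⟨ solve 5 (λ V T K θ E →
                  V :* (V :* (K :* T :- E) :- T :* (K :* T)) :- θ :* (V :* (V :* T :- T :* T))
                  := V :* (T :* (V :- T) :* (K :- θ) :- V :* E)) refl V T K θ₂ Es ⟩
            V * (T * (V - T) * (K - θ₂) - V * Es)                          ∎

    -- If (v − t)(k − θ₂) ≤ v (k − θ₁), every set of size t has
    -- E[S,Sᶜ] / vol(S) ≤ (k − θ₁)/k: its cut is at most t (k − θ₁) and its volume is kt.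
    ratio-bound : ∀ S {t} → size G S ≡ t → .{{ℕ.NonZero k}} → .{{ℕ.NonZero t}} →
                  (fromℕ v - fromℕ t) * (K - θ₂) ≤ fromℕ v * (K - θ₁) →
                  ratio G F S ≤ (K - θ₁) * K ⁻¹
    ratio-bound S {t} refl condition =
      ≤-respˡ-≡ (cong (λ q → Es * q ⁻¹) vol-regular)
        (≤-divide (fromℕ-nonneg k) (fromℕ-nonZero k) (fromℕ-nonneg t) (fromℕ-nonZero t) cut≤t[K-θ₁])
      where
        open RegularCuts F G k regular S using (T; vol-regular)
        Es : Carrier
        Es = fromℕ (edgesOut G S)

        cut≤t[K-θ₁] : Es ≤ T * (K - θ₁)
        cut≤t[K-θ₁] = ≤-rescale (fromℕ-nonneg v) V≢0 (fromℕ-nonneg t)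
          (≤-respʳ-≡ (cut-bound S) (*-assoc T _ _)) condition

-- The numerical hypothesis of the theorem, for v = 2t (using θ₂ ≤ θ₁) or
-- v = 2t + 1, gives  (v − t)(κ − θ₂) ≤ v (κ − θ₁).
module ParityCondition (F : OrderedField) (t : ℕ) (κ θ₁ θ₂ : OrderedField.Carrier F) where
  open OrderedField F
  open FieldArithmetic F
  open ≡-Reasoning

  T H : Carrier
  T = fromℕ t
  H = fromℕ t * κ - fromℕ (2 ℕ.* t ℕ.+ 1) * θ₁ + fromℕ (t ℕ.+ 1) * θ₂

  -- fromℕ 1 is 1# + 0#, which is also how the solver reads the constant 1
  fromℕ-2t : fromℕ (2 ℕ.* t) ≡ T + T
  fromℕ-2t = trans (cong fromℕ (cong (t ℕ.+_) (ℕP.+-identityʳ t))) (fromℕ-+ t t)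

  fromℕ-2t+1 : fromℕ (2 ℕ.* t ℕ.+ 1) ≡ T + T + fromℕ 1
  fromℕ-2t+1 = trans (fromℕ-+ (2 ℕ.* t) 1) (cong (_+ fromℕ 1) fromℕ-2t)

  H-expanded : H ≡ T * κ - (T + T + fromℕ 1) * θ₁ + (T + fromℕ 1) * θ₂
  H-expanded = cong₂ (λ p q → T * κ - p * θ₁ + q * θ₂) fromℕ-2t+1 (fromℕ-+ t 1)

  even-gap : H + (θ₁ - θ₂) ≡ fromℕ (2 ℕ.* t) * (κ - θ₁) - (fromℕ (2 ℕ.* t) - T) * (κ - θ₂)
  even-gap = begin
      H + (θ₁ - θ₂)                                         ≡⟨ cong (_+ (θ₁ - θ₂)) H-expanded ⟩
      T * κ - (T + T + fromℕ 1) * θ₁ + (T + fromℕ 1) * θ₂ + (θ₁ - θ₂)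
        ≡⟨ solve 4 (λ T κ a b → T :* κ :- (T :+ T :+ con (ℤ.+ 1)) :* a :+ (T :+ con (ℤ.+ 1)) :* b :+ (a :- b)
             := (T :+ T) :* (κ :- a) :- ((T :+ T) :- T) :* (κ :- b)) refl T κ θ₁ θ₂ ⟩
      (T + T) * (κ - θ₁) - ((T + T) - T) * (κ - θ₂)
        ≡⟨ cong (λ V → V * (κ - θ₁) - (V - T) * (κ - θ₂)) (sym fromℕ-2t) ⟩
      fromℕ (2 ℕ.* t) * (κ - θ₁) - (fromℕ (2 ℕ.* t) - T) * (κ - θ₂) ∎

  odd-gap : H ≡ fromℕ (2 ℕ.* t ℕ.+ 1) * (κ - θ₁) - (fromℕ (2 ℕ.* t ℕ.+ 1) - T) * (κ - θ₂)
  odd-gap = begin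
      H                                                     ≡⟨ H-expanded ⟩
      T * κ - (T + T + fromℕ 1) * θ₁ + (T + fromℕ 1) * θ₂
        ≡⟨ solve 4 (λ T κ a b → T :* κ :- (T :+ T :+ con (ℤ.+ 1)) :* a :+ (T :+ con (ℤ.+ 1)) :* b
             := (T :+ T :+ con (ℤ.+ 1)) :* (κ :- a) :- ((T :+ T :+ con (ℤ.+ 1)) :- T) :* (κ :- b)) refl T κ θ₁ θ₂ ⟩
      (T + T + fromℕ 1) * (κ - θ₁) - ((T + T + fromℕ 1) - T) * (κ - θ₂)
        ≡⟨ cong (λ V → V * (κ - θ₁) - (V - T) * (κ - θ₂)) (sym fromℕ-2t+1) ⟩
      fromℕ (2 ℕ.* t ℕ.+ 1) * (κ - θ₁) - (fromℕ (2 ℕ.* t ℕ.+ 1) - T) * (κ - θ₂) ∎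

  parity-condition : ∀ {v} → v ≡ 2 ℕ.* t ⊎ v ≡ 2 ℕ.* t ℕ.+ 1 → θ₂ ≤ θ₁ → 0# ≤ H →
                     (fromℕ v - T) * (κ - θ₂) ≤ fromℕ v * (κ - θ₁)
  parity-condition (inj₁ refl) θ₂≤θ₁ 0≤H = 0≤y-x⇒x≤y (≤-respʳ-≡ (+-nonneg 0≤H (x≤y⇒0≤y-x θ₂≤θ₁)) even-gap)
  parity-condition (inj₂ refl) θ₂≤θ₁ 0≤H = 0≤y-x⇒x≤y (≤-respʳ-≡ 0≤H odd-gap)

initial-segment : ∀ n → ℕ → Fin n → Bool
initial-segment (suc n) zero    _       = false
initial-segment (suc n) (suc t) zero    = true
initial-segment (suc n) (suc t) (suc i) = initial-segment n t i

size-initial-segment : ∀ n t → t ℕ.≤ n → count (initial-segment n t) ≡ t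
size-initial-segment zero    zero    _           = refl
size-initial-segment (suc n) zero    _           = count-nothing n
  where
    count-nothing : ∀ n → count {n} (λ _ → false) ≡ 0
    count-nothing zero    = refl
    count-nothing (suc n) = count-nothing n
size-initial-segment (suc n) (suc t) (ℕ.s≤s t≤n) = cong suc (size-initial-segment n t t≤n)

initial-segment-nonempty : ∀ n t → .{{ℕ.NonZero t}} → t ℕ.≤ n → ∃[ i ] initial-segment n t i ≡ true
initial-segment-nonempty (suc n) (suc t) _ = zero , refl

count-nonZero : ∀ {n} (p : Fin n → Bool) i → p i ≡ true → ℕ.NonZero (count p)
count-nonZero p zero    pᵢ≡true rewrite pᵢ≡true = _
count-nonZero p (suc i) pᵢ≡true with p zero
... | true  = _
... | false = count-nonZero (λ j → p (suc j)) i pᵢ≡true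

-- two distinct vertices force v ≥ 2, hence t ≥ 1
half-nonZero : ∀ {v t} (x y : Fin v) → x ≢ y → v ≡ 2 ℕ.* t ⊎ v ≡ 2 ℕ.* t ℕ.+ 1 → ℕ.NonZero t
half-nonZero {t = suc t} _    _    _   _           = _
half-nonZero {t = zero}  ()   _    _   (inj₁ refl)
half-nonZero {t = zero}  zero zero x≢y (inj₂ refl) = ⊥-elim (x≢y refl)

2t≤v : ∀ {v t} → v ≡ 2 ℕ.* t ⊎ v ≡ 2 ℕ.* t ℕ.+ 1 → 2 ℕ.* t ℕ.≤ v
2t≤v (inj₁ refl) = ℕP.≤-refl
2t≤v (inj₂ refl) = ℕP.m≤m+n _ 1

lemma4p4 : (F : OrderedField) → let open OrderedField F in
    ∀ {v : ℕ} (G : Graph v) (k : ℕ) (θ₁ θ₂ : Carrier) (t : ℕ) →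
    IsStronglyRegular G k →
    HasEigenvalues G F (fromℕ k) θ₁ θ₂ →
    (v ≡ 2 ℕ.* t ⊎ v ≡ 2 ℕ.* t ℕ.+ 1) →
    0# ≤ fromℕ t * fromℕ k - fromℕ (2 ℕ.* t ℕ.+ 1) * θ₁ + fromℕ (t ℕ.+ 1) * θ₂ →
    ∀ h → IsCheegerConstant G F h →
    h ≤ (fromℕ k - θ₁) * (fromℕ k) ⁻¹
lemma4p4 F {v} G k θ₁ θ₂ t
         (regular , (λ′ , μ , adjacent-common , nonadjacent-common) , connected , (x₀ , y₀ , x₀≢y₀ , x₀≁y₀))
         (_ , ev₁ , ev₂ , _ , θ₁<k , θ₂<θ₁) v≡2t⊎2t+1 hypothesis h (_ , h-minimal) =
  ≤-trans (h-minimal S S-admissible)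
          (ratio-bound S |S|≡t {{k-nonZero}} {{t-nonZero}}
            (parity-condition v≡2t⊎2t+1 (proj₁ θ₂<θ₁) hypothesis))
  where
    open FieldArithmetic F using (≤-trans)
    open StronglyRegularAlgebra F G k regular λ′ μ adjacent-common nonadjacent-common using (module Spectrum)
    open Spectrum θ₁ θ₂ ev₁ ev₂ θ₁<k θ₂<θ₁ using (ratio-bound)
    open ParityCondition F t (OrderedField.fromℕ F k) θ₁ θ₂ using (parity-condition)

    S : VSubset G
    S = initial-segment v t

    t≤v : t ℕ.≤ v
    t≤v = ℕP.≤-trans (ℕP.m≤m+n t (t ℕ.+ 0)) (2t≤v {t = t} v≡2t⊎2t+1)

    |S|≡t : size G S ≡ t
    |S|≡t = size-initial-segment v t t≤v

    t-nonZero : ℕ.NonZero t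
    t-nonZero = half-nonZero {t = t} x₀ y₀ x₀≢y₀ v≡2t⊎2t+1

    -- x₀ has a neighbour (on a path to y₀), so the valency is positive
    k-nonZero : ℕ.NonZero k
    k-nonZero with connected x₀ y₀ x₀≢y₀ x₀≁y₀
    ... | z , x₀∼z , _ = subst ℕ.NonZero (regular x₀) (count-nonZero (adj G x₀) z x₀∼z)

    S-admissible : Admissible G S
    S-admissible = initial-segment-nonempty v t {{t-nonZero}} t≤v
                 , subst (λ n → 2 ℕ.* n ℕ.≤ v) (sym |S|≡t) (2t≤v {t = t} v≡2t⊎2t+1)
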